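{- Let $q=p^\ell$ be a prime power with characteristic $p$, and $d\ge0$ an integer. Write $d+1=s\,(q-q/p)+r$ with integers $s\ge0$ and $0\le r<q-q/p$. Let $k\ge s+1$ and define $e^\star\in\{0,\dots,q-1\}^k$ by $e^\star_i=q-q/p$ for $1\le i\le s$, $e^\star_{s+1}=q-1$, and $e^\star_j=0$ for $j\ge s+2$; let $d^\star=|e^\star|_1$. Then for every $g:\mathbb{F}_q^k\to\mathbb{F}_q$ with $\deg(g)\le d^\star-1$, \[\Pr_{\alpha\in\mathbb{F}_q^k}[g(\alpha)\ne\alpha^{e^\star}]\ge\frac{1}{q^{s+1}},\] where $\alpha$ is uniform.
   Context: Every function $g:\mathbb{F}_q^k\to\mathbb{F}_q$ has a unique polynomial representation $\sum_{e\in\{0,\dots,q-1\}^k}C_ex^e$ with $x^e=\prod_ix_i^{e_i}$; $\deg(g)$ is the maximum of $|e|_1=\sum_ie_i$ over $e$ with $C_e\ne0$. For $\alpha\in\mathbb{F}_q^k$, $\alpha^e=\prod_i\alpha_i^{e_i}$. -}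

module Defs where

open import Data.Nat as ℕ using (ℕ; zero; suc)
open import Data.Fin using (Fin; toℕ)
open import Data.Vec using (Vec; []; _∷_; zipWith; foldr; tabulate)
open import Data.List as L using (List; length; filter; allFin; concatMap)
open import Data.Product using (∃; _×_)
open import Relation.Binary.PropositionalEquality using (_≡_; _≢_)
open import Relation.Nullary using (¬_)
open import Relation.Nullary.Decidable using (¬?)
open import Algebra.Structures using (IsCommutativeRing)
import Data.Fin.Properties as FinP

-- A field structure whose carrier is Fin q (with propositional equality).
-- Every finite field with q elements is isomorphic to one of these.
record FieldOn (q : ℕ) : Set where
  field
    _+_ _*_ : Fin q → Fin q → Fin q
    -_      : Fin q → Fin q
    0# 1#   : Fin q
    isCommutativeRing : IsCommutativeRing _≡_ _+_ _*_ -_ 0# 1#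
    0≢1     : 0# ≢ 1#
    inverse : ∀ x → x ≢ 0# → ∃ λ y → x * y ≡ 1#
  infixl 6 _+_
  infixl 7 _*_

module _ {q : ℕ} (F : FieldOn q) where
  open FieldOn F

  natF : ℕ → Fin q
  natF zero = 0#
  natF (suc n) = 1# + natF n

  -- the field has characteristic p (p·1 = 0, p prime given separately)
  HasChar : ℕ → Set
  HasChar p = natF p ≡ 0#

  pow : Fin q → ℕ → Fin q
  pow x zero = 1#
  pow x (suc n) = x * pow x n

  mono : ∀ {k} → Vec (Fin q) k → Vec ℕ k → Fin q
  mono α e = foldr (λ _ → Fin q) _*_ 1# (zipWith pow α e)

  sumF : List (Fin q) → Fin q
  sumF = L.foldr _+_ 0#

allVecs : ∀ {A : Set} → List A → (k : ℕ) → List (Vec A k)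
allVecs xs zero = [] L.∷ L.[]
allVecs xs (suc k) = concatMap (λ x → L.map (x ∷_) (allVecs xs k)) xs

weight : ∀ {q k} → Vec (Fin q) k → ℕ
weight e = foldr (λ _ → ℕ) (λ a b → toℕ a ℕ.+ b) 0 e

toℕs : ∀ {q k} → Vec (Fin q) k → Vec ℕ k
toℕs = Data.Vec.map toℕ

module _ {q : ℕ} (F : FieldOn q) where
  open FieldOn F

  evalPoly : ∀ {k} → (Vec (Fin q) k → Fin q) → Vec (Fin q) k → Fin q
  evalPoly {k} C α = sumF F (L.map (λ e → C e * mono F α (toℕs e)) (allVecs (allFin q) k))

  -- deg(g) ≤ D : g has a representation Σ_e C_e x^e, e ∈ {0..q-1}^k,
  -- whose nonzero coefficients all have |e|_1 ≤ D (the representation is unique)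
  DegLe : ∀ {k} → (Vec (Fin q) k → Fin q) → ℕ → Set
  DegLe {k} g D = ∃ λ (C : Vec (Fin q) k → Fin q) →
    (∀ e → C e ≢ 0# → weight e ℕ.≤ D) × (∀ α → g α ≡ evalPoly C α)

  disagree : ∀ {k} → (Vec (Fin q) k → Fin q) → (Vec (Fin q) k → Fin q) → ℕ
  disagree {k} g h = length (filter (λ α → ¬? (g α FinP.≟ h α)) (allVecs (allFin q) k))

estar : (k s m q : ℕ) → Vec ℕ k
estar k s m q = tabulate λ i → f (toℕ i)
  where
  f : ℕ → ℕ
  f i with i ℕ.<? s | i ℕ.≟ s
  ... | Relation.Nullary.yes _ | _ = m
  ... | Relation.Nullary.no _ | Relation.Nullary.yes _ = q ℕ.∸ 1
  ... | Relation.Nullary.no _ | Relation.Nullary.no _ = 0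

-- Fix any exponent vector t and any polynomial H of individual degrees < q in which x^t is the
-- only monomial of weight ≥ |t|. Then H is nonzero at no fewer than q^k / q^(number of nonzero
-- entries of t) points. Induct on k by splitting off the first variable x₁. If t₁ = 0, each of
-- the q specialisations x₁ := a still has x^t′ as its unique heaviest monomial. If t₁ ≠ 0, the
-- coefficient of x₁^t₁ has x^t′ as its unique heaviest monomial, and wherever that coefficient is
-- nonzero, H(·, α) is a nonzero univariate polynomial of degree < q, hence nonzero at some point
-- of F_q; so the count loses at most a factor q. Apply this to x^e⋆ − g, whose unique heaviest
-- monomial is x^e⋆ because deg g < |e⋆|, and note that e⋆ has at most s + 1 nonzero entries.

module Submission where

open import Defs
open import Level using (0ℓ)
open import Algebra.Bundles using (CommutativeRing)
import Algebra.Properties.Ring as RingProperties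
import Algebra.Properties.Semiring.Sum as SemiringSum
open import Data.Fin as Fin using (Fin; toℕ)
import Data.Fin.Properties as Finₚ
open import Data.Product using (∃; _×_; _,_; proj₁; proj₂)
open import Data.Sum using (_⊎_; inj₁; inj₂)
open import Data.Empty using (⊥-elim)
open import Data.Nat as ℕ using (ℕ; zero; suc; _∸_; _^_; _≤_; _<_; z≤n; s≤s; z<s; _<?_; NonZero; NonTrivial; >-nonZero; nonTrivial⇒n>1)
open import Data.Nat.Primality using (Prime; prime⇒nonTrivial; prime⇒nonZero)
import Data.Nat.Properties as ℕₚ
open import Data.Nat.ListAction using (sum)
open import Data.List as List using (List; []; _∷_; _++_; length; filter; allFin; concatMap)
import Data.List.Properties as Listₚ
import Data.List.Relation.Unary.All as All
import Data.List.Relation.Unary.Any as Any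
open Any using (Any; any?)
open import Data.List.Membership.Propositional using (lose)
open import Data.List.Membership.Propositional.Properties using (∈-allFin)
open import Data.List.Relation.Binary.Sublist.Propositional using (⊆-refl)
open import Data.List.Relation.Binary.Sublist.Propositional.Properties using (filter⁺; length-mono-≤)
open import Data.Vec as Vec using (Vec) renaming (_∷_ to _∷ᵥ_; [] to []ᵥ)
import Data.Vec.Properties as Vecₚ
open import Data.Bool using (true; false)
open import Function using (_∘_)
open import Function.Definitions using (Injective)
open import Relation.Binary.PropositionalEquality
open import Relation.Nullary using (Dec; does; yes; no; ¬?)
open import Relation.Unary using (Pred; Decidable; _⊆_)
open import Relation.Unary.Properties using (_∪?_)

module _ {q : ℕ} (F : FieldOn q) where

  open FieldOn F

  commutativeRing : CommutativeRing 0ℓ 0ℓ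
  commutativeRing = record { isCommutativeRing = isCommutativeRing }

  open CommutativeRing commutativeRing
    using ( _-_; +-assoc; +-identityˡ; +-identityʳ; *-assoc; *-comm; *-identityˡ; *-identityʳ
          ; distribˡ; distribʳ; zeroˡ; zeroʳ; -‿inverseˡ; ring; semiring; commutativeSemiring)
  open RingProperties ring using (-0#≈0#; +-identityˡ-unique; x∙y⁻¹≈ε⇒x≈y)
  open SemiringSum semiring using (sum-syntax; sum-cong-≗; sum-replicate-zero; *-distribˡ-sum) renaming (sum to ∑)
  open import Algebra.Solver.Ring.NaturalCoefficients.Default commutativeSemiring
    using (solve; _:=_; _:+_; _:*_)

  private
    x*[y*z]≡y*[x*z] : ∀ x y z → x * (y * z) ≡ y * (x * z)
    x*[y*z]≡y*[x*z] = solve 3 (λ x y z → x :* (y :* z) := y :* (x :* z)) refl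

  x-y+y≡x : ∀ x y → x - y + y ≡ x
  x-y+y≡x x y = begin
    x + - y + y    ≡⟨ +-assoc x (- y) y ⟩
    x + (- y + y)  ≡⟨ cong (x +_) (-‿inverseˡ y) ⟩
    x + 0#         ≡⟨ +-identityʳ x ⟩
    x              ∎
    where open ≡-Reasoning

  x≢0⇒x*y≡0⇒y≡0 : ∀ {x y} → x ≢ 0# → x * y ≡ 0# → y ≡ 0#
  x≢0⇒x*y≡0⇒y≡0 {x} {y} x≢0 xy≡0 with inverse x x≢0
  ... | x⁻¹ , x*x⁻¹≡1 = begin
    y               ≡⟨ sym (*-identityˡ y) ⟩
    1# * y          ≡⟨ cong (_* y) (trans (sym x*x⁻¹≡1) (*-comm x x⁻¹)) ⟩
    x⁻¹ * x * y     ≡⟨ *-assoc x⁻¹ x y ⟩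
    x⁻¹ * (x * y)   ≡⟨ cong (x⁻¹ *_) xy≡0 ⟩
    x⁻¹ * 0#        ≡⟨ zeroʳ x⁻¹ ⟩
    0#              ∎
    where open ≡-Reasoning

  ∑ₗ : {A : Set} → List A → (A → Fin q) → Fin q
  ∑ₗ xs f = sumF F (List.map f xs)

  module _ {A : Set} where

    ∑ₗ-cong : (xs : List A) {f g : A → Fin q} → f ≗ g → ∑ₗ xs f ≡ ∑ₗ xs g
    ∑ₗ-cong []       f≗g = refl
    ∑ₗ-cong (x ∷ xs) f≗g = cong₂ _+_ (f≗g x) (∑ₗ-cong xs f≗g)

    ∑ₗ-zero : (xs : List A) {f : A → Fin q} → (∀ x → f x ≡ 0#) → ∑ₗ xs f ≡ 0#
    ∑ₗ-zero []       f≡0 = refl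
    ∑ₗ-zero (x ∷ xs) f≡0 = trans (cong₂ _+_ (f≡0 x) (∑ₗ-zero xs f≡0)) (+-identityˡ 0#)

    ∑ₗ-++ : (xs ys : List A) (f : A → Fin q) → ∑ₗ (xs ++ ys) f ≡ ∑ₗ xs f + ∑ₗ ys f
    ∑ₗ-++ []       ys f = sym (+-identityˡ _)
    ∑ₗ-++ (x ∷ xs) ys f = trans (cong (f x +_) (∑ₗ-++ xs ys f)) (sym (+-assoc _ _ _))

    ∑ₗ-map : {B : Set} (h : B → A) (xs : List B) (f : A → Fin q) → ∑ₗ (List.map h xs) f ≡ ∑ₗ xs (f ∘ h)
    ∑ₗ-map h []       f = refl
    ∑ₗ-map h (x ∷ xs) f = cong (f (h x) +_) (∑ₗ-map h xs f)

    ∑ₗ-concatMap : {B : Set} (g : B → List A) (xs : List B) (f : A → Fin q) →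
                   ∑ₗ (concatMap g xs) f ≡ ∑ₗ xs (λ x → ∑ₗ (g x) f)
    ∑ₗ-concatMap g []       f = refl
    ∑ₗ-concatMap g (x ∷ xs) f = trans (∑ₗ-++ (g x) _ f) (cong (∑ₗ (g x) f +_) (∑ₗ-concatMap g xs f))

    ∑ₗ-distrib-+ : (xs : List A) (f g : A → Fin q) → ∑ₗ xs (λ x → f x + g x) ≡ ∑ₗ xs f + ∑ₗ xs g
    ∑ₗ-distrib-+ []       f g = sym (+-identityˡ 0#)
    ∑ₗ-distrib-+ (x ∷ xs) f g =
      trans (cong (f x + g x +_) (∑ₗ-distrib-+ xs f g)) (interchange (f x) (g x) _ _)
      where
      interchange : ∀ a b c d → a + b + (c + d) ≡ a + c + (b + d)
      interchange = solve 4 (λ a b c d → a :+ b :+ (c :+ d) := a :+ c :+ (b :+ d)) refl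

    *-distribˡ-∑ₗ : (a : Fin q) (xs : List A) (f : A → Fin q) → a * ∑ₗ xs f ≡ ∑ₗ xs (λ x → a * f x)
    *-distribˡ-∑ₗ a []       f = zeroʳ a
    *-distribˡ-∑ₗ a (x ∷ xs) f = trans (distribˡ a (f x) _) (cong (a * f x +_) (*-distribˡ-∑ₗ a xs f))

  ∑ₗ-comm : {A B : Set} (xs : List A) (ys : List B) (f : A → B → Fin q) →
            ∑ₗ xs (λ x → ∑ₗ ys (f x)) ≡ ∑ₗ ys (λ y → ∑ₗ xs (λ x → f x y))
  ∑ₗ-comm []       ys f = sym (∑ₗ-zero ys (λ _ → refl))
  ∑ₗ-comm (x ∷ xs) ys f = trans (cong (∑ₗ ys (f x) +_) (∑ₗ-comm xs ys f)) (sym (∑ₗ-distrib-+ ys (f x) _))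

  ∑ₗ-tabulate : ∀ n {A : Set} (g : Fin n → A) (f : A → Fin q) → ∑ₗ (List.tabulate g) f ≡ ∑[ i < n ] f (g i)
  ∑ₗ-tabulate zero    g f = refl
  ∑ₗ-tabulate (suc n) g f = cong (f (g Fin.zero) +_) (∑ₗ-tabulate n (g ∘ Fin.suc) f)

  ∑-single : ∀ {n} (f : Fin n → Fin q) (i : Fin n) → (∀ j → j ≢ i → f j ≡ 0#) → ∑[ j < n ] f j ≡ f i
  ∑-single {suc n} f Fin.zero    f≡0 =
    trans (cong (f Fin.zero +_) (trans (sum-cong-≗ {n} (λ j → f≡0 (Fin.suc j) λ ())) (sum-replicate-zero n)))
          (+-identityʳ _)
  ∑-single {suc n} f (Fin.suc i) f≡0 =
    trans (cong₂ _+_ (f≡0 Fin.zero λ ()) (∑-single (f ∘ Fin.suc) i λ j j≢i → f≡0 (Fin.suc j) (j≢i ∘ Finₚ.suc-injective)))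
          (+-identityˡ _)

  -- Univariate polynomials

  evalPoly₁ : (n : ℕ) → (Fin n → Fin q) → Fin q → Fin q
  evalPoly₁ n c a = ∑[ i < n ] (c i * pow F a (toℕ i))

  evalPoly₁-suc : ∀ n (c : Fin (suc n) → Fin q) a →
                  evalPoly₁ (suc n) c a ≡ c Fin.zero + a * evalPoly₁ n (c ∘ Fin.suc) a
  evalPoly₁-suc n c a = cong₂ _+_ (*-identityʳ _) (begin
    ∑[ i < n ] (c (Fin.suc i) * (a * pow F a (toℕ i)))  ≡⟨ sum-cong-≗ {n} (λ i → x*[y*z]≡y*[x*z] _ a _) ⟩
    ∑[ i < n ] (a * (c (Fin.suc i) * pow F a (toℕ i)))  ≡⟨ sym (*-distribˡ-sum {n} a _) ⟩
    a * evalPoly₁ n (c ∘ Fin.suc) a                      ∎)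
    where open ≡-Reasoning

  -- Synthetic division by x - r: coefficient i of the quotient is c_{i+1} + c_{i+2} r + c_{i+3} r² + ⋯
  quotient : ∀ {n} → Fin q → (Fin (suc n) → Fin q) → Fin n → Fin q
  quotient {suc n} r c Fin.zero    = evalPoly₁ (suc n) (c ∘ Fin.suc) r
  quotient {suc n} r c (Fin.suc i) = quotient r (c ∘ Fin.suc) i

  evalPoly₁-divide : ∀ n (c : Fin (suc n) → Fin q) r x →
                     evalPoly₁ (suc n) c x ≡ (x - r) * evalPoly₁ n (quotient r c) x + evalPoly₁ (suc n) c r
  evalPoly₁-divide zero    c r x = sym (trans (cong (_+ evalPoly₁ 1 c r) (zeroʳ (x - r))) (+-identityˡ _))
  evalPoly₁-divide (suc n) c r x = begin
    evalPoly₁ (suc (suc n)) c x                            ≡⟨ evalPoly₁-suc (suc n) c x ⟩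
    c₀ + x * evalPoly₁ (suc n) c′ x                        ≡⟨ cong (λ y → c₀ + y * evalPoly₁ (suc n) c′ x) (sym (x-y+y≡x x r)) ⟩
    c₀ + (x - r + r) * evalPoly₁ (suc n) c′ x              ≡⟨ cong (λ p → c₀ + (x - r + r) * p) (evalPoly₁-divide n c′ r x) ⟩
    c₀ + (x - r + r) * ((x - r) * Q + ρ)                   ≡⟨ regroup c₀ (x - r) r Q ρ ⟩
    (x - r) * (ρ + (x - r + r) * Q) + (c₀ + r * ρ)         ≡⟨ cong (λ y → (x - r) * (ρ + y * Q) + (c₀ + r * ρ)) (x-y+y≡x x r) ⟩
    (x - r) * (ρ + x * Q) + (c₀ + r * ρ)                   ≡⟨ cong₂ (λ u v → (x - r) * u + v)
                                                                    (sym (evalPoly₁-suc n (quotient r c) x))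
                                                                    (sym (evalPoly₁-suc (suc n) c r)) ⟩
    (x - r) * evalPoly₁ (suc n) (quotient r c) x + evalPoly₁ (suc (suc n)) c r ∎
    where
    open ≡-Reasoning
    c′ : Fin (suc n) → Fin q
    c′ = c ∘ Fin.suc
    c₀ Q ρ : Fin q
    c₀ = c Fin.zero
    Q  = evalPoly₁ n (quotient r c′) x
    ρ  = evalPoly₁ (suc n) c′ r
    regroup : ∀ c₀ u r Q ρ → c₀ + (u + r) * (u * Q + ρ) ≡ u * (ρ + (u + r) * Q) + (c₀ + r * ρ)
    regroup = solve 5 (λ c₀ u r Q ρ → c₀ :+ (u :+ r) :* (u :* Q :+ ρ) := u :* (ρ :+ (u :+ r) :* Q) :+ (c₀ :+ r :* ρ)) refl

  head≡0 : ∀ n (c : Fin (suc n) → Fin q) r →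
           evalPoly₁ (suc n) c r ≡ 0# → evalPoly₁ n (c ∘ Fin.suc) r ≡ 0# → c Fin.zero ≡ 0#
  head≡0 n c r c[r]≡0 c′[r]≡0 = begin
    c Fin.zero                                  ≡⟨ sym (+-identityʳ _) ⟩
    c Fin.zero + 0#                             ≡⟨ cong (c Fin.zero +_) (sym (trans (cong (r *_) c′[r]≡0) (zeroʳ r))) ⟩
    c Fin.zero + r * evalPoly₁ n (c ∘ Fin.suc) r ≡⟨ sym (evalPoly₁-suc n c r) ⟩
    evalPoly₁ (suc n) c r                       ≡⟨ c[r]≡0 ⟩
    0#                                          ∎
    where open ≡-Reasoning

  quotient≡0⇒coefficients≡0 : ∀ n (c : Fin (suc n) → Fin q) r →
    evalPoly₁ (suc n) c r ≡ 0# → (∀ i → quotient r c i ≡ 0#) → ∀ i → c i ≡ 0#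
  quotient≡0⇒coefficients≡0 zero    c r c[r]≡0 _      Fin.zero    = head≡0 zero c r c[r]≡0 refl
  quotient≡0⇒coefficients≡0 (suc n) c r c[r]≡0 quot≡0 Fin.zero    = head≡0 (suc n) c r c[r]≡0 (quot≡0 Fin.zero)
  quotient≡0⇒coefficients≡0 (suc n) c r _      quot≡0 (Fin.suc i) =
    quotient≡0⇒coefficients≡0 n (c ∘ Fin.suc) r (quot≡0 Fin.zero) (quot≡0 ∘ Fin.suc) i

  roots⇒coefficients≡0 : ∀ n (c : Fin n → Fin q) (ρ : Fin n → Fin q) → Injective _≡_ _≡_ ρ →
                         (∀ i → evalPoly₁ n c (ρ i) ≡ 0#) → ∀ i → c i ≡ 0#
  roots⇒coefficients≡0 zero    _ _ _           _      ()
  roots⇒coefficients≡0 (suc n) c ρ ρ-injective c[ρ]≡0 =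
    quotient≡0⇒coefficients≡0 n c r (c[ρ]≡0 Fin.zero)
      (roots⇒coefficients≡0 n (quotient r c) (ρ ∘ Fin.suc) (Finₚ.suc-injective ∘ ρ-injective) quot[ρ]≡0)
    where
    r : Fin q
    r = ρ Fin.zero
    quot[ρ]≡0 : ∀ j → evalPoly₁ n (quotient r c) (ρ (Fin.suc j)) ≡ 0#
    quot[ρ]≡0 j = x≢0⇒x*y≡0⇒y≡0 ρⱼ-r≢0 (+-identityˡ-unique _ _ (begin
      (ρⱼ - r) * evalPoly₁ n (quotient r c) ρⱼ + evalPoly₁ (suc n) c r  ≡⟨ sym (evalPoly₁-divide n c r ρⱼ) ⟩
      evalPoly₁ (suc n) c ρⱼ                                            ≡⟨ c[ρ]≡0 (Fin.suc j) ⟩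
      0#                                                                ≡⟨ sym (c[ρ]≡0 Fin.zero) ⟩
      evalPoly₁ (suc n) c r                                             ∎))
      where
      open ≡-Reasoning
      ρⱼ : Fin q
      ρⱼ = ρ (Fin.suc j)
      ρⱼ-r≢0 : ρⱼ - r ≢ 0#
      ρⱼ-r≢0 ρⱼ-r≡0 with () ← ρ-injective (x∙y⁻¹≈ε⇒x≈y ρⱼ r ρⱼ-r≡0)

  -- Polynomials in k variables

  vectors : (k : ℕ) → List (Vec (Fin q) k)
  vectors = allVecs (allFin q)

  monomial : ∀ {k} → Vec (Fin q) k → Vec (Fin q) k → Fin q
  monomial α e = mono F α (toℕs e)

  evalPoly-∷ : ∀ {k} (H : Vec (Fin q) (suc k) → Fin q) a α →
    evalPoly F H (a ∷ᵥ α) ≡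
    ∑ₗ (allFin q) (λ x → ∑ₗ (vectors k) (λ e → H (x ∷ᵥ e) * (pow F a (toℕ x) * monomial α e)))
  evalPoly-∷ {k} H a α =
    trans (∑ₗ-concatMap _ (allFin q) _) (∑ₗ-cong (allFin q) (λ x → ∑ₗ-map (x ∷ᵥ_) (vectors k) _))

  evalPoly-as-evalPoly₁ : ∀ {k} (H : Vec (Fin q) (suc k) → Fin q) a α →
    evalPoly F H (a ∷ᵥ α) ≡ evalPoly₁ q (λ x → evalPoly F (λ e → H (x ∷ᵥ e)) α) a
  evalPoly-as-evalPoly₁ {k} H a α =
    trans (evalPoly-∷ H a α) (trans (∑ₗ-cong (allFin q) coefficient) (∑ₗ-tabulate q (λ x → x) _))
    where
    coefficient : ∀ x → ∑ₗ (vectors k) (λ e → H (x ∷ᵥ e) * (pow F a (toℕ x) * monomial α e))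
                        ≡ evalPoly F (λ e → H (x ∷ᵥ e)) α * pow F a (toℕ x)
    coefficient x = trans (∑ₗ-cong (vectors k) (λ e → x*[y*z]≡y*[x*z] (H (x ∷ᵥ e)) _ _))
                          (trans (sym (*-distribˡ-∑ₗ _ (vectors k) _)) (*-comm _ _))

  specialise : ∀ {k} → (Vec (Fin q) (suc k) → Fin q) → Fin q → Vec (Fin q) k → Fin q
  specialise H a e = ∑ₗ (allFin q) (λ x → H (x ∷ᵥ e) * pow F a (toℕ x))

  evalPoly-specialise : ∀ {k} (H : Vec (Fin q) (suc k) → Fin q) a α →
                        evalPoly F H (a ∷ᵥ α) ≡ evalPoly F (specialise H a) α
  evalPoly-specialise {k} H a α =
    trans (evalPoly-∷ H a α) (trans (∑ₗ-comm (allFin q) (vectors k) _) (∑ₗ-cong (vectors k) coefficient))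
    where
    coefficient : ∀ e → ∑ₗ (allFin q) (λ x → H (x ∷ᵥ e) * (pow F a (toℕ x) * monomial α e))
                        ≡ specialise H a e * monomial α e
    coefficient e = begin
      ∑ₗ (allFin q) (λ x → H (x ∷ᵥ e) * (pow F a (toℕ x) * monomial α e))  ≡⟨ ∑ₗ-cong (allFin q) (λ x →
                                                                             trans (sym (*-assoc _ _ _)) (*-comm _ _)) ⟩
      ∑ₗ (allFin q) (λ x → monomial α e * (H (x ∷ᵥ e) * pow F a (toℕ x)))  ≡⟨ sym (*-distribˡ-∑ₗ _ (allFin q) _) ⟩
      monomial α e * specialise H a e                                      ≡⟨ *-comm _ _ ⟩
      specialise H a e * monomial α e                                      ∎
      where open ≡-Reasoning

  δ₁ : Fin q → Fin q → Fin q
  δ₁ a x with a Finₚ.≟ x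
  ... | yes _ = 1#
  ... | no  _ = 0#

  δ₁-refl : ∀ a → δ₁ a a ≡ 1#
  δ₁-refl a with a Finₚ.≟ a
  ... | yes _   = refl
  ... | no  a≢a = ⊥-elim (a≢a refl)

  δ₁-≢ : ∀ a x → x ≢ a → δ₁ a x ≡ 0#
  δ₁-≢ a x x≢a with a Finₚ.≟ x
  ... | yes a≡x = ⊥-elim (x≢a (sym a≡x))
  ... | no  _   = refl

  δ : ∀ {k} → Vec (Fin q) k → Vec (Fin q) k → Fin q
  δ []ᵥ       []ᵥ       = 1#
  δ (a ∷ᵥ t) (x ∷ᵥ e) = δ₁ a x * δ t e

  δ-refl : ∀ {k} (t : Vec (Fin q) k) → δ t t ≡ 1#
  δ-refl []ᵥ       = refl
  δ-refl (a ∷ᵥ t) = trans (cong₂ _*_ (δ₁-refl a) (δ-refl t)) (*-identityˡ 1#)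

  δ-≢ : ∀ {k} (t e : Vec (Fin q) k) → e ≢ t → δ t e ≡ 0#
  δ-≢ []ᵥ       []ᵥ       e≢t = ⊥-elim (e≢t refl)
  δ-≢ (a ∷ᵥ t) (x ∷ᵥ e) e≢t with x Finₚ.≟ a
  ... | no  x≢a  = trans (cong (_* δ t e) (δ₁-≢ a x x≢a)) (zeroˡ _)
  ... | yes refl = trans (cong (δ₁ a x *_) (δ-≢ t e (e≢t ∘ cong (x ∷ᵥ_)))) (zeroʳ _)

  ∑ₗ-δ : ∀ k (t : Vec (Fin q) k) (f : Vec (Fin q) k → Fin q) → ∑ₗ (vectors k) (λ e → δ t e * f e) ≡ f t
  ∑ₗ-δ zero    []ᵥ       f = trans (+-identityʳ _) (*-identityˡ _)
  ∑ₗ-δ (suc k) (a ∷ᵥ t) f = begin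
    ∑ₗ (vectors (suc k)) (λ e → δ (a ∷ᵥ t) e * f e)   ≡⟨ ∑ₗ-concatMap _ (allFin q) _ ⟩
    ∑ₗ (allFin q) (λ x → ∑ₗ (List.map (x ∷ᵥ_) (vectors k)) (λ e → δ (a ∷ᵥ t) e * f e))
                                                      ≡⟨ ∑ₗ-cong (allFin q) (λ x → trans (∑ₗ-map (x ∷ᵥ_) (vectors k) _) (sift x)) ⟩
    ∑ₗ (allFin q) (λ x → δ₁ a x * f (x ∷ᵥ t))         ≡⟨ ∑ₗ-tabulate q (λ x → x) _ ⟩
    ∑[ x < q ] (δ₁ a x * f (x ∷ᵥ t))                  ≡⟨ ∑-single _ a (λ x x≢a → trans (cong (_* _) (δ₁-≢ a x x≢a)) (zeroˡ _)) ⟩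
    δ₁ a a * f (a ∷ᵥ t)                               ≡⟨ trans (cong (_* f (a ∷ᵥ t)) (δ₁-refl a)) (*-identityˡ _) ⟩
    f (a ∷ᵥ t)                                        ∎
    where
    open ≡-Reasoning
    sift : ∀ x → ∑ₗ (vectors k) (λ e → δ₁ a x * δ t e * f (x ∷ᵥ e)) ≡ δ₁ a x * f (x ∷ᵥ t)
    sift x = begin
      ∑ₗ (vectors k) (λ e → δ₁ a x * δ t e * f (x ∷ᵥ e))    ≡⟨ ∑ₗ-cong (vectors k) (λ e → *-assoc _ _ _) ⟩
      ∑ₗ (vectors k) (λ e → δ₁ a x * (δ t e * f (x ∷ᵥ e)))  ≡⟨ sym (*-distribˡ-∑ₗ _ (vectors k) _) ⟩
      δ₁ a x * ∑ₗ (vectors k) (λ e → δ t e * f (x ∷ᵥ e))    ≡⟨ cong (δ₁ a x *_) (∑ₗ-δ k t (f ∘ (x ∷ᵥ_))) ⟩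
      δ₁ a x * f (x ∷ᵥ t)                                   ∎

  evalPoly-δ-sub : ∀ {k} (t : Vec (Fin q) k) (C : Vec (Fin q) k → Fin q) α →
                   evalPoly F (λ e → δ t e - C e) α + evalPoly F C α ≡ monomial α t
  evalPoly-δ-sub {k} t C α = begin
    evalPoly F (λ e → δ t e - C e) α + evalPoly F C α          ≡⟨ sym (∑ₗ-distrib-+ (vectors k) _ _) ⟩
    ∑ₗ (vectors k) (λ e → (δ t e - C e) * m e + C e * m e)     ≡⟨ ∑ₗ-cong (vectors k) (λ e →
                                                                  trans (sym (distribʳ (m e) _ _)) (cong (_* m e) (x-y+y≡x _ _))) ⟩
    ∑ₗ (vectors k) (λ e → δ t e * m e)                         ≡⟨ ∑ₗ-δ k t m ⟩
    m t                                                        ∎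
    where
    open ≡-Reasoning
    m : Vec (Fin q) k → Fin q
    m = monomial α


  UniqueHeaviest : ∀ {k} → Vec (Fin q) k → (Vec (Fin q) k → Fin q) → Set
  UniqueHeaviest t H = H t ≢ 0# × (∀ e → weight t ≤ weight e → e ≢ t → H e ≡ 0#)

  UniqueHeaviest-∷ : ∀ {k} x (t : Vec (Fin q) k) H → UniqueHeaviest (x ∷ᵥ t) H → UniqueHeaviest t (λ e → H (x ∷ᵥ e))
  UniqueHeaviest-∷ x t H (H[t]≢0 , H≡0) =
    H[t]≢0 , λ e |t|≤|e| e≢t → H≡0 (x ∷ᵥ e) (ℕₚ.+-monoʳ-≤ (toℕ x) |t|≤|e|) (e≢t ∘ Vecₚ.∷-injectiveʳ)

  UniqueHeaviest-specialise : ∀ {k} x (t : Vec (Fin q) k) H → toℕ x ≡ 0 → UniqueHeaviest (x ∷ᵥ t) H →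
                       ∀ a → UniqueHeaviest t (specialise H a)
  UniqueHeaviest-specialise x t H x≡0 (H[t]≢0 , H≡0) a = specialise[t]≢0 , specialise≡0
    where
    other-terms≡0 : ∀ e → weight t ≤ weight e → ∀ y → y ∷ᵥ e ≢ x ∷ᵥ t → H (y ∷ᵥ e) * pow F a (toℕ y) ≡ 0#
    other-terms≡0 e |t|≤|e| y ne =
      trans (cong (_* _) (H≡0 (y ∷ᵥ e) (subst (_≤ toℕ y ℕ.+ weight e) (cong (ℕ._+ weight t) (sym x≡0))
                                                (ℕₚ.≤-trans |t|≤|e| (ℕₚ.m≤n+m _ (toℕ y)))) ne))
            (zeroˡ _)
    specialise[t]≢0 : specialise H a t ≢ 0#
    specialise[t]≢0 specialise[t]≡0 = H[t]≢0 (begin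
      H (x ∷ᵥ t)                           ≡⟨ sym (*-identityʳ _) ⟩
      H (x ∷ᵥ t) * pow F a 0               ≡⟨ cong (λ n → H (x ∷ᵥ t) * pow F a n) (sym x≡0) ⟩
      H (x ∷ᵥ t) * pow F a (toℕ x)         ≡⟨ sym (∑-single _ x (λ y y≢x → other-terms≡0 t ℕₚ.≤-refl y (y≢x ∘ Vecₚ.∷-injectiveˡ))) ⟩
      ∑[ y < q ] (H (y ∷ᵥ t) * pow F a (toℕ y)) ≡⟨ sym (∑ₗ-tabulate q (λ y → y) _) ⟩
      specialise H a t                     ≡⟨ specialise[t]≡0 ⟩
      0#                                   ∎)
      where open ≡-Reasoning
    specialise≡0 : ∀ e → weight t ≤ weight e → e ≢ t → specialise H a e ≡ 0#
    specialise≡0 e |t|≤|e| e≢t = ∑ₗ-zero (allFin q) (λ y → other-terms≡0 e |t|≤|e| y (e≢t ∘ Vecₚ.∷-injectiveʳ))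

  UniqueHeaviest-δ-sub : ∀ {k} (t : Vec (Fin q) k) (C : Vec (Fin q) k → Fin q) →
                  (∀ e → C e ≢ 0# → weight e < weight t) → UniqueHeaviest t (λ e → δ t e - C e)
  UniqueHeaviest-δ-sub t C C≢0⇒light =
    (λ H[t]≡0 → 0≢1 (trans (sym H[t]≡0) H[t]≡1)) ,
    λ e |t|≤|e| e≢t → trans (cong₂ _-_ (δ-≢ t e e≢t) (C≡0 e |t|≤|e|)) x-0≡x
    where
    x-0≡x : ∀ {x} → x - 0# ≡ x
    x-0≡x = trans (cong (_ +_) -0#≈0#) (+-identityʳ _)
    C≡0 : ∀ e → weight t ≤ weight e → C e ≡ 0#
    C≡0 e |t|≤|e| with C e Finₚ.≟ 0#
    ... | yes C[e]≡0 = C[e]≡0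
    ... | no  C[e]≢0 = ⊥-elim (ℕₚ.<⇒≱ (C≢0⇒light e C[e]≢0) |t|≤|e|)
    H[t]≡1 : δ t t - C t ≡ 1#
    H[t]≡1 = trans (cong₂ _-_ (δ-refl t) (C≡0 t ℕₚ.≤-refl)) x-0≡x

  evalPoly-δ-sub≡0 : ∀ {k} (t : Vec (Fin q) k) (C : Vec (Fin q) k → Fin q) α →
                     monomial α t ≡ evalPoly F C α → evalPoly F (λ e → δ t e - C e) α ≡ 0#
  evalPoly-δ-sub≡0 t C α xᵗ≡C = +-identityˡ-unique _ _ (trans (evalPoly-δ-sub t C α) xᵗ≡C)

-- Counting

open import Data.Nat using (_+_; _*_)
open import Data.Nat.Properties

private
  variable
    A B : Set

count : {P : Pred A 0ℓ} → Decidable P → List A → ℕ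
count P? xs = length (filter P? xs)

count-++ : {P : Pred A 0ℓ} (P? : Decidable P) (xs ys : List A) → count P? (xs ++ ys) ≡ count P? xs + count P? ys
count-++ P? xs ys = trans (cong length (Listₚ.filter-++ P? xs ys)) (Listₚ.length-++ (filter P? xs))

count-concatMap : {P : Pred A 0ℓ} (P? : Decidable P) (g : B → List A) (xs : List B) →
                  count P? (concatMap g xs) ≡ sum (List.map (count P? ∘ g) xs)
count-concatMap P? g []       = refl
count-concatMap P? g (x ∷ xs) =
  trans (count-++ P? (g x) _) (cong (count P? (g x) +_) (count-concatMap P? g xs))

count-map : {P : Pred A 0ℓ} (P? : Decidable P) (h : B → A) (xs : List B) → count P? (List.map h xs) ≡ count (P? ∘ h) xs
count-map P? h []       = refl
count-map P? h (x ∷ xs) with does (P? (h x))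
... | true  = cong suc (count-map P? h xs)
... | false = count-map P? h xs

count-mono : {P Q : Pred A 0ℓ} (P? : Decidable P) (Q? : Decidable Q) → P ⊆ Q → (xs : List A) → count P? xs ≤ count Q? xs
count-mono P? Q? P⊆Q xs = length-mono-≤ (filter⁺ P? Q? {xs} {xs} (λ { refl → P⊆Q }) ⊆-refl)

count-∪ : {P Q : Pred A 0ℓ} (P? : Decidable P) (Q? : Decidable Q) (xs : List A) →
          count (P? ∪? Q?) xs ≤ count P? xs + count Q? xs
count-∪ P? Q? []       = z≤n
count-∪ P? Q? (x ∷ xs) with ih ← count-∪ P? Q? xs | P? x | Q? x
... | yes _ | yes _ = s≤s (≤-trans ih (+-monoʳ-≤ (count P? xs) (n≤1+n _)))
... | yes _ | no  _ = s≤s ih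
... | no  _ | yes _ = ≤-trans (s≤s ih) (≤-reflexive (sym (+-suc _ _)))
... | no  _ | no  _ = ih

count-any≤sum-count : {R : B → Pred A 0ℓ} (R? : ∀ b → Decidable (R b)) (bs : List B) (xs : List A) →
                      count (λ x → any? (λ b → R? b x) bs) xs ≤ sum (List.map (λ b → count (R? b) xs) bs)
count-any≤sum-count R? []       xs = ≤-reflexive (cong length (Listₚ.filter-none _ (All.universal (λ _ ()) xs)))
count-any≤sum-count R? (b ∷ bs) xs = begin
  count (λ x → any? (λ c → R? c x) (b ∷ bs)) xs      ≤⟨ count-mono _ _ Any.toSum xs ⟩
  count (R? b ∪? (λ x → any? (λ c → R? c x) bs)) xs  ≤⟨ count-∪ (R? b) _ xs ⟩
  count (R? b) xs + count (λ x → any? (λ c → R? c x) bs) xs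
                                                      ≤⟨ +-monoʳ-≤ _ (count-any≤sum-count R? bs xs) ⟩
  count (R? b) xs + sum (List.map (λ c → count (R? c) xs) bs) ∎
  where open ≤-Reasoning

length*≤sum*ʳ : ∀ {n c} (f : A → ℕ) (xs : List A) → (∀ x → n ≤ f x * c) →
                length xs * n ≤ sum (List.map f xs) * c
length*≤sum*ʳ f []       _ = z≤n
length*≤sum*ʳ {c = c} f (x ∷ xs) n≤fx*c =
  ≤-trans (+-mono-≤ (n≤fx*c x) (length*≤sum*ʳ f xs n≤fx*c))
          (≤-reflexive (sym (*-distribʳ-+ c (f x) _)))

count-allVecs-suc : ∀ {k} {P : Pred (Vec A (suc k)) 0ℓ} (P? : Decidable P) (xs : List A) →
                    count P? (allVecs xs (suc k)) ≡ sum (List.map (λ a → count (P? ∘ (a ∷ᵥ_)) (allVecs xs k)) xs)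
count-allVecs-suc {k = k} P? xs =
  trans (count-concatMap P? _ xs) (cong sum (Listₚ.map-cong (λ a → count-map P? (a ∷ᵥ_) (allVecs xs k)) xs))

support : ∀ {k} → Vec ℕ k → ℕ
support []ᵥ           = 0
support (zero  ∷ᵥ v) = support v
support (suc _ ∷ᵥ v) = suc (support v)

module _ {q : ℕ} (F : FieldOn q) where

  open FieldOn F using (0#)
  private module R = CommutativeRing (commutativeRing F)

  nonzeros : ∀ {k} → (Vec (Fin q) k → Fin q) → ℕ
  nonzeros {k} f = count (λ α → ¬? (f α Finₚ.≟ 0#)) (vectors F k)

  nonzeros-∷ : ∀ {k} (f : Vec (Fin q) (suc k) → Fin q) →
               nonzeros f ≡ sum (List.map (λ a → nonzeros (f ∘ (a ∷ᵥ_))) (allFin q))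
  nonzeros-∷ f = count-allVecs-suc _ (allFin q)

  nonzeros-mono : ∀ {k} (f g : Vec (Fin q) k → Fin q) → (∀ α → g α ≡ 0# → f α ≡ 0#) → nonzeros f ≤ nonzeros g
  nonzeros-mono {k} f g g≡0⇒f≡0 =
    count-mono (λ α → ¬? (f α Finₚ.≟ 0#)) (λ α → ¬? (g α Finₚ.≟ 0#)) (λ f≢0 g≡0 → f≢0 (g≡0⇒f≡0 _ g≡0)) (vectors F k)

  coefficient-nonzeros≤nonzeros : ∀ {k} x (H : Vec (Fin q) (suc k) → Fin q) →
                                  nonzeros (evalPoly F (λ e → H (x ∷ᵥ e))) ≤ nonzeros (evalPoly F H)
  coefficient-nonzeros≤nonzeros {k} x H = begin
    nonzeros (evalPoly F (λ e → H (x ∷ᵥ e)))                 ≤⟨ count-mono _ _ some-slice≢0 (vectors F k) ⟩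
    count (λ α → any? (λ a → slice? a α) (allFin q)) (vectors F k) ≤⟨ count-any≤sum-count slice? (allFin q) (vectors F k) ⟩
    sum (List.map (λ a → nonzeros (evalPoly F H ∘ (a ∷ᵥ_))) (allFin q)) ≡⟨ sym (nonzeros-∷ (evalPoly F H)) ⟩
    nonzeros (evalPoly F H)                                  ∎
    where
    open ≤-Reasoning
    slice? : ∀ a α → Dec (evalPoly F H (a ∷ᵥ α) ≢ 0#)
    slice? a α = ¬? (evalPoly F H (a ∷ᵥ α) Finₚ.≟ 0#)
    -- A nonzero coefficient of x₁^x keeps α ↦ H(·, α) a nonzero univariate polynomial of degree < q.
    some-slice≢0 : ∀ {α} → evalPoly F (λ e → H (x ∷ᵥ e)) α ≢ 0# → Any (λ a → evalPoly F H (a ∷ᵥ α) ≢ 0#) (allFin q)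
    some-slice≢0 {α} coefficient≢0 with any? (λ a → slice? a α) (allFin q)
    ... | yes some≢0 = some≢0
    ... | no  none≢0 = ⊥-elim (coefficient≢0 (roots⇒coefficients≡0 F q _ (λ a → a) (λ a≡b → a≡b) slices≡0 x))
      where
      slices≡0 : ∀ a → evalPoly₁ F q (λ y → evalPoly F (λ e → H (y ∷ᵥ e)) α) a ≡ 0#
      slices≡0 a with evalPoly F H (a ∷ᵥ α) Finₚ.≟ 0#
      ... | yes slice≡0 = trans (sym (evalPoly-as-evalPoly₁ F H a α)) slice≡0
      ... | no  slice≢0 = ⊥-elim (none≢0 (lose (∈-allFin a) slice≢0))

  q^k≤nonzeros*q^support : ∀ {k} (t : Vec (Fin q) k) (H : Vec (Fin q) k → Fin q) → UniqueHeaviest F t H →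
                           q ^ k ≤ nonzeros (evalPoly F H) * q ^ support (toℕs t)
  q^k≤nonzeros*q^support []ᵥ H (H[]≢0 , _) with evalPoly F H []ᵥ Finₚ.≟ 0#
  ... | yes H[]≡0 = ⊥-elim (H[]≢0 (trans (sym (trans (R.+-identityʳ _) (R.*-identityʳ _))) H[]≡0))
  ... | no  _     = ≤-refl
  q^k≤nonzeros*q^support {suc k} (x ∷ᵥ t) H heaviest = by-first-exponent (toℕ x) refl
    where
    open ≤-Reasoning
    s : ℕ
    s = support (toℕs t)
    by-first-exponent : ∀ n → toℕ x ≡ n → q * q ^ k ≤ nonzeros (evalPoly F H) * q ^ support (n ∷ᵥ toℕs t)
    by-first-exponent zero toℕx≡0 = begin
      q * q ^ k                                                                  ≡⟨ cong (_* q ^ k) (sym (Listₚ.length-tabulate {n = q} (λ a → a))) ⟩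
      length (allFin q) * q ^ k                                                  ≤⟨ length*≤sum*ʳ _ (allFin q) slice-bound ⟩
      sum (List.map (λ a → nonzeros (evalPoly F H ∘ (a ∷ᵥ_))) (allFin q)) * q ^ s ≡⟨ cong (_* q ^ s) (sym (nonzeros-∷ (evalPoly F H))) ⟩
      nonzeros (evalPoly F H) * q ^ s                                            ∎
      where
      slice-bound : ∀ a → q ^ k ≤ nonzeros (evalPoly F H ∘ (a ∷ᵥ_)) * q ^ s
      slice-bound a = ≤-trans (q^k≤nonzeros*q^support t (specialise F H a) (UniqueHeaviest-specialise F x t H toℕx≡0 heaviest a))
                              (*-monoˡ-≤ _ (nonzeros-mono _ _ (λ α slice≡0 → trans (sym (evalPoly-specialise F H a α)) slice≡0)))
    by-first-exponent (suc _) _ = begin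
      q * q ^ k                                                  ≤⟨ *-monoʳ-≤ q (q^k≤nonzeros*q^support t _ (UniqueHeaviest-∷ F x t H heaviest)) ⟩
      q * (nonzeros (evalPoly F (λ e → H (x ∷ᵥ e))) * q ^ s)    ≤⟨ *-monoʳ-≤ q (*-monoˡ-≤ _ (coefficient-nonzeros≤nonzeros x H)) ⟩
      q * (nonzeros (evalPoly F H) * q ^ s)                      ≡⟨ x*[y*z]≡y*[x*z] q (nonzeros (evalPoly F H)) (q ^ s) ⟩
      nonzeros (evalPoly F H) * (q * q ^ s)                      ∎
      where
      x*[y*z]≡y*[x*z] : ∀ x y z → x * (y * z) ≡ y * (x * z)
      x*[y*z]≡y*[x*z] x y z = trans (sym (*-assoc x y z)) (trans (cong (_* z) (*-comm x y)) (*-assoc y x z))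

  q^k≤disagree*q^support : ∀ {k D} (t : Vec (Fin q) k) (g : Vec (Fin q) k → Fin q) → D < weight t → DegLe F g D →
                           q ^ k ≤ disagree F g (λ α → monomial F α t) * q ^ support (toℕs t)
  q^k≤disagree*q^support {k} t g D<|t| (C , C≢0⇒|e|≤D , g≡C) =
    ≤-trans (q^k≤nonzeros*q^support t H (UniqueHeaviest-δ-sub F t C (λ e C[e]≢0 → ≤-<-trans (C≢0⇒|e|≤D e C[e]≢0) D<|t|)))
            (*-monoˡ-≤ _ (count-mono (λ α → ¬? (evalPoly F H α Finₚ.≟ 0#)) (λ α → ¬? (g α Finₚ.≟ monomial F α t))
                                     differs (vectors F k)))
    where
    H : Vec (Fin q) k → Fin q
    H e = δ F t e R.- C e
    differs : ∀ {α} → evalPoly F H α ≢ 0# → g α ≢ monomial F α t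
    differs {α} H≢0 g≡xᵗ = H≢0 (evalPoly-δ-sub≡0 F t C α (trans (sym g≡xᵗ) (g≡C α)))

weight≡sum∘toℕs : ∀ {q k} (t : Vec (Fin q) k) → weight t ≡ Vec.sum (toℕs t)
weight≡sum∘toℕs []ᵥ       = refl
weight≡sum∘toℕs (x ∷ᵥ t) = cong (toℕ x +_) (weight≡sum∘toℕs t)

lookup≤sum : ∀ {k} (v : Vec ℕ k) i → Vec.lookup v i ≤ Vec.sum v
lookup≤sum (x ∷ᵥ v) Fin.zero    = m≤m+n x _
lookup≤sum (x ∷ᵥ v) (Fin.suc i) = ≤-trans (lookup≤sum v i) (m≤n+m _ x)

toℕs-onto : ∀ {q k} (v : Vec ℕ k) → (∀ i → Vec.lookup v i < q) → ∃ λ (t : Vec (Fin q) k) → toℕs t ≡ v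
toℕs-onto []ᵥ       _      = []ᵥ , refl
toℕs-onto (x ∷ᵥ v) v[i]<q with toℕs-onto v (v[i]<q ∘ Fin.suc)
... | t , toℕs[t]≡v = Fin.fromℕ< (v[i]<q Fin.zero) ∷ᵥ t , cong₂ _∷ᵥ_ (Finₚ.toℕ-fromℕ< _) toℕs[t]≡v

support≤ : ∀ {k} (v : Vec ℕ k) S → (∀ i → S ≤ toℕ i → Vec.lookup v i ≡ 0) → support v ≤ S
support≤ []ᵥ       S       _     = z≤n
support≤ (x ∷ᵥ v) zero    v≡0 rewrite v≡0 Fin.zero z≤n = support≤ v zero (λ i _ → v≡0 (Fin.suc i) z≤n)
support≤ (x ∷ᵥ v) (suc S) v≡0 = ≤-trans (head-step x) (s≤s (support≤ v S (λ i S≤i → v≡0 (Fin.suc i) (s≤s S≤i))))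
  where
  head-step : ∀ x → support (x ∷ᵥ v) ≤ suc (support v)
  head-step zero    = n≤1+n _
  head-step (suc _) = ≤-refl

private
  rhs : {x y : ℕ} → x ≡ y → ℕ
  rhs {y = y} _ = y

lookup-estar : ∀ {k} s m q (i : Fin k) →
               (toℕ i < s × Vec.lookup (estar k s m q) i ≡ m) ⊎
               (toℕ i ≡ s × Vec.lookup (estar k s m q) i ≡ q ∸ 1) ⊎
               (s < toℕ i × Vec.lookup (estar k s m q) i ≡ 0)
lookup-estar {k} s m q i =
  subst (λ x → (toℕ i < s × x ≡ m) ⊎ (toℕ i ≡ s × x ≡ q ∸ 1) ⊎ (s < toℕ i × x ≡ 0)) (sym lookup≡entry) cases
  where
  -- Unification with estar's definition names its where-bound entry function, exposing its tests to `with`.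
  entry : ℕ
  entry = rhs {x = Vec.lookup (estar k s m q) i} (Vecₚ.lookup∘tabulate _ i)
  lookup≡entry : Vec.lookup (estar k s m q) i ≡ entry
  lookup≡entry = Vecₚ.lookup∘tabulate _ i
  cases : (toℕ i < s × entry ≡ m) ⊎ (toℕ i ≡ s × entry ≡ q ∸ 1) ⊎ (s < toℕ i × entry ≡ 0)
  cases with toℕ i <? s | toℕ i ℕ.≟ s
  ... | yes i<s | _       = inj₁ (i<s , refl)
  ... | no  _   | yes i≡s = inj₂ (inj₁ (i≡s , refl))
  ... | no  i≮s | no  i≢s = inj₂ (inj₂ (≤∧≢⇒< (≮⇒≥ i≮s) (i≢s ∘ sym) , refl))

estar-entries<q : ∀ {k} s m q → m < q → 0 < q → ∀ (i : Fin k) → Vec.lookup (estar k s m q) i < q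
estar-entries<q s m q m<q 0<q i with lookup-estar s m q i
... | inj₁ (_ , x≡m)              = subst (_< q) (sym x≡m) m<q
... | inj₂ (inj₁ (_ , x≡q∸1))     = subst (_< q) (sym x≡q∸1) (∸-monoʳ-< {o = 0} z<s 0<q)
... | inj₂ (inj₂ (_ , x≡0))       = subst (_< q) (sym x≡0) 0<q

lookup-estar-s : ∀ {k} s m q (i : Fin k) → toℕ i ≡ s → Vec.lookup (estar k s m q) i ≡ q ∸ 1
lookup-estar-s s m q i i≡s with lookup-estar s m q i
... | inj₁ (i<s , _)          = ⊥-elim (<-irrefl i≡s i<s)
... | inj₂ (inj₁ (_ , x≡q∸1)) = x≡q∸1
... | inj₂ (inj₂ (s<i , _))   = ⊥-elim (<-irrefl (sym i≡s) s<i)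

support-estar : ∀ k s m q → support (estar k s m q) ≤ s + 1
support-estar k s m q = support≤ (estar k s m q) (s + 1) beyond-s≡0
  where
  beyond-s≡0 : ∀ i → s + 1 ≤ toℕ i → Vec.lookup (estar k s m q) i ≡ 0
  beyond-s≡0 i s+1≤i with lookup-estar s m q i
  ... | inj₁ (i<s , _)          = ⊥-elim (<-asym i<s (subst (_≤ toℕ i) (+-comm s 1) s+1≤i))
  ... | inj₂ (inj₁ (i≡s , _))   = ⊥-elim (<-irrefl (sym i≡s) (subst (_≤ toℕ i) (+-comm s 1) s+1≤i))
  ... | inj₂ (inj₂ (_ , x≡0))   = x≡0

1≤sum-estar : ∀ {k} s m q → 1 < q → s < k → 1 ≤ Vec.sum (estar k s m q)
1≤sum-estar {k} s m q 1<q s<k = begin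
  1                                             ≤⟨ ∸-monoˡ-≤ 1 1<q ⟩
  q ∸ 1                                         ≡⟨ sym (lookup-estar-s s m q (Fin.fromℕ< s<k) (Finₚ.toℕ-fromℕ< s<k)) ⟩
  Vec.lookup (estar k s m q) (Fin.fromℕ< s<k)   ≤⟨ lookup≤sum (estar k s m q) (Fin.fromℕ< s<k) ⟩
  Vec.sum (estar k s m q)                       ∎
  where open ≤-Reasoning

q^k≤disagree-estar*q^[s+1] : ∀ {q} (F : FieldOn q) k s m → m < q → 1 < q → s < k → (g : Vec (Fin q) k → Fin q) →
                             DegLe F g (Vec.sum (estar k s m q) ∸ 1) →
                             q ^ k ≤ disagree F g (λ α → mono F α (estar k s m q)) * q ^ (s + 1)
q^k≤disagree-estar*q^[s+1] {q} F k s m m<q 1<q s<k g deg[g]≤ = begin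
  q ^ k                                                      ≤⟨ q^k≤disagree*q^support F t g D<|t| deg[g]≤ ⟩
  disagree F g (λ α → monomial F α t) * q ^ support (toℕs t) ≡⟨ cong (λ v → disagree F g (λ α → mono F α v) * q ^ support v) toℕs[t]≡e⋆ ⟩
  disagree F g (λ α → mono F α e⋆) * q ^ support e⋆          ≤⟨ *-monoʳ-≤ (disagree F g (λ α → mono F α e⋆))
                                                                          (^-monoʳ-≤ q {{>-nonZero 0<q}} (support-estar k s m q)) ⟩
  disagree F g (λ α → mono F α e⋆) * q ^ (s + 1)             ∎
  where
  open ≤-Reasoning
  e⋆ : Vec ℕ k
  e⋆ = estar k s m q
  0<q : 0 < q
  0<q = <⇒≤ 1<q
  t : Vec (Fin q) k
  t = proj₁ (toℕs-onto e⋆ (estar-entries<q s m q m<q 0<q))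
  toℕs[t]≡e⋆ : toℕs t ≡ e⋆
  toℕs[t]≡e⋆ = proj₂ (toℕs-onto e⋆ (estar-entries<q s m q m<q 0<q))
  D<|t| : Vec.sum e⋆ ∸ 1 < weight t
  D<|t| = subst (Vec.sum e⋆ ∸ 1 <_) (sym (trans (weight≡sum∘toℕs t) (cong Vec.sum toℕs[t]≡e⋆)))
                (∸-monoʳ-< {o = 0} z<s (1≤sum-estar {k} s m q 1<q s<k))

lemma4p4 : (p ℓ q : ℕ) → Prime p → 1 ≤ ℓ → q ≡ p ^ ℓ →
    (F : FieldOn q) → HasChar F p →
    (d s r : ℕ) → suc d ≡ s * (q ∸ p ^ (ℓ ∸ 1)) + r → r < q ∸ p ^ (ℓ ∸ 1) →
    (k : ℕ) → s + 1 ≤ k →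
    (g : Vec (Fin q) k → Fin q) →
    DegLe F g (Vec.sum (estar k s (q ∸ p ^ (ℓ ∸ 1)) q) ∸ 1) →
    q ^ k ≤ disagree F g (λ α → mono F α (estar k s (q ∸ p ^ (ℓ ∸ 1)) q)) * q ^ (s + 1)
lemma4p4 p ℓ _ p-prime 1≤ℓ refl F _ _ s _ _ _ k s+1≤k =
  q^k≤disagree-estar*q^[s+1] F k s (p ^ ℓ ∸ p ^ (ℓ ∸ 1))
    (∸-monoʳ-< (m^n>0 p (ℓ ∸ 1)) (^-monoʳ-≤ p (m∸n≤m ℓ 1)))
    (^-monoʳ-< p (nonTrivial⇒n>1 p) 1≤ℓ)
    (subst (_≤ k) (+-comm s 1) s+1≤k)
  where
  instance
    p-nonTrivial : NonTrivial p
    p-nonTrivial = prime⇒nonTrivial p-prime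
    p-nonZero : NonZero p
    p-nonZero = prime⇒nonZero p-prime
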